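{- Let $n\ge 2$ and let $SD_{8n}=\langle a,b : a^{4n}=e,\ b^2=e,\ ba=a^{2n-1}b\rangle$. (i) If $n$ is odd, then $CSCom(SD_{8n})\cong H[\Gamma_1,\dots,\Gamma_{2n+6}]$, where $H=K_4\vee(K_{2n-2}\cup K_4)$ with vertices $1,\dots,4$ the first $K_4$, vertices $5,\dots,2n+2$ the vertices of $K_{2n-2}$, and vertices $2n+3,\dots,2n+6$ the second $K_4$; and $\Gamma_1=\dots=\Gamma_4=K_1$, $\Gamma_i=K_2$ for $5\le i\le 2n+2$, $\Gamma_{2n+3}=\dots=\Gamma_{2n+6}=K_n$. (ii) If $n$ is even, then $CSCom(SD_{8n})\cong H[\Gamma_1,\dots,\Gamma_{2n+3}]$, where $H=K_2\vee(K_{2n-1}\cup K_1\cup K_1)$ with vertices $1,2$ the $K_2$, vertices $3,\dots,2n+1$ the vertices of $K_{2n-1}$, and vertices $2n+2,2n+3$ the two $K_1$'s; and $\Gamma_1=\Gamma_2=K_1$, $\Gamma_i=K_2$ for $3\le i\le 2n+1$, $\Gamma_{2n+2}=\Gamma_{2n+3}=K_{2n}$.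
   Context: For a finite group $G$ and $x\in G$, $[x]$ denotes the conjugacy class of $x$. The conjugacy supercommuting graph $CSCom(G)$ is the simple graph with vertex set $G$ in which two distinct vertices $x,y$ are adjacent iff there exist $x'\in[x]$, $y'\in[y]$ with $x'y'=y'x'$ ($x'=y'$ permitted, so distinct conjugate elements are always adjacent). $K_m$ is the complete graph on $m$ vertices; $\cup$ is disjoint union and $\vee$ is join. For a graph $H$ on $\{1,\dots,k\}$ and graphs $\Gamma_1,\dots,\Gamma_k$, the generalized composition $H[\Gamma_1,\dots,\Gamma_k]$ has vertex set the disjoint union of the $V(\Gamma_i)$, with $u\in V(\Gamma_i)$, $v\in V(\Gamma_j)$ adjacent iff either $i=j$ and $u\sim v$ in $\Gamma_i$, or $i\neq j$ and $i\sim j$ in $H$. -}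

module Defs where

open import Data.Nat using (ℕ; zero; suc; _+_; _*_; _∸_; NonZero)
open import Data.Nat.Properties using (m*n≢0)
open import Data.Nat.DivMod using (_mod_)
open import Data.Fin using (Fin; toℕ)
open import Data.Bool using (Bool; true; false; _xor_)
open import Data.Product using (Σ; _×_; _,_; ∃)
open import Data.Sum using (_⊎_; inj₁; inj₂)
open import Data.Unit using (⊤)
open import Data.Empty using (⊥)
open import Relation.Nullary using (¬_)
open import Relation.Binary.PropositionalEquality using (_≡_; _≢_; subst)

record Graph : Set₁ where
  field
    V   : Set
    Adj : V → V → Set
open Graph public

K : ℕ → Graph
K m = record { V = Fin m ; Adj = λ x y → x ≢ y }

_∪ᴳ_ : Graph → Graph → Graph
Γ ∪ᴳ Δ = record { V = V Γ ⊎ V Δ ; Adj = adj }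
  where
  adj : V Γ ⊎ V Δ → V Γ ⊎ V Δ → Set
  adj (inj₁ x) (inj₁ y) = Adj Γ x y
  adj (inj₂ x) (inj₂ y) = Adj Δ x y
  adj (inj₁ _) (inj₂ _) = ⊥
  adj (inj₂ _) (inj₁ _) = ⊥

_∨ᴳ_ : Graph → Graph → Graph
Γ ∨ᴳ Δ = record { V = V Γ ⊎ V Δ ; Adj = adj }
  where
  adj : V Γ ⊎ V Δ → V Γ ⊎ V Δ → Set
  adj (inj₁ x) (inj₁ y) = Adj Γ x y
  adj (inj₂ x) (inj₂ y) = Adj Δ x y
  adj (inj₁ _) (inj₂ _) = ⊤
  adj (inj₂ _) (inj₁ _) = ⊤

compose : (H : Graph) → (V H → Graph) → Graph
compose H Γ = record { V = Σ (V H) (λ i → V (Γ i)) ; Adj = adj }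
  where
  adj : Σ (V H) (λ i → V (Γ i)) → Σ (V H) (λ i → V (Γ i)) → Set
  adj (i , u) (j , v) =
    Σ (i ≡ j) (λ p → Adj (Γ j) (subst (λ k → V (Γ k)) p u) v)
    ⊎ (i ≢ j × Adj H i j)

record _≅ᴳ_ (Γ Δ : Graph) : Set where
  field
    to      : V Γ → V Δ
    from    : V Δ → V Γ
    from-to : ∀ x → from (to x) ≡ x
    to-from : ∀ y → to (from y) ≡ y
    adj→    : ∀ x y → Adj Γ x y → Adj Δ (to x) (to y)
    adj←    : ∀ x y → Adj Δ (to x) (to y) → Adj Γ x y

-- The semidihedral group SD_{8n} = ⟨a,b : a^{4n}=e, b²=e, ba=a^{2n-1}b⟩,
-- realised by its normal form: (i , j) stands for a^i b^j with
-- i ∈ ℤ/4n and j ∈ {0,1} (false = 0, true = 1).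
-- Multiplication: a^i b^j · a^k b^l = a^{i + k r^j} b^{j+l}, r = 2n-1.

module SD (n : ℕ) .{{_ : NonZero n}} where

  M : ℕ
  M = 4 * n

  instance
    M≢0 : NonZero M
    M≢0 = m*n≢0 4 n

  r : ℕ
  r = 2 * n ∸ 1

  Elem : Set
  Elem = Fin M × Bool

  twist : Bool → ℕ → ℕ
  twist false k = k
  twist true  k = k * r

  _·_ : Elem → Elem → Elem
  (i , j) · (k , l) = ((toℕ i + twist j (toℕ k)) mod M , j xor l)

  -- (a^i b^j)⁻¹ = a^{-i r^j} b^j   (since r² ≡ 1 mod 4n)
  inv : Elem → Elem
  inv (i , j) = (twist j (M ∸ toℕ i) mod M , j)

  conj : Elem → Elem → Elem
  conj g x = (g · x) · inv g

  _∈Cl_ : Elem → Elem → Set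
  y ∈Cl x = ∃ λ g → y ≡ conj g x

  CSCom : Graph
  CSCom = record
    { V   = Elem
    ; Adj = λ x y → x ≢ y ×
              (∃ λ x' → ∃ λ y' → x' ∈Cl x × y' ∈Cl y × (x' · y') ≡ (y' · x'))
    }

Hodd : ℕ → Graph
Hodd n = K 4 ∨ᴳ (K (2 * n ∸ 2) ∪ᴳ K 4)

Γodd : (n : ℕ) → V (Hodd n) → Graph
Γodd n (inj₁ _)        = K 1
Γodd n (inj₂ (inj₁ _)) = K 2
Γodd n (inj₂ (inj₂ _)) = K n

Heven : ℕ → Graph
Heven n = K 2 ∨ᴳ ((K (2 * n ∸ 1) ∪ᴳ K 1) ∪ᴳ K 1)

Γeven : (n : ℕ) → V (Heven n) → Graph
Γeven n (inj₁ _)                 = K 1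
Γeven n (inj₂ (inj₁ (inj₁ _)))   = K 2
Γeven n (inj₂ (inj₁ (inj₂ _)))   = K (2 * n)
Γeven n (inj₂ (inj₂ _))          = K (2 * n)

-- Write the elements of SD_{8n} as a^i b^j, with r = 2n − 1 and r² ≡ 1 (mod 4n). Conjugation
-- keeps j, sends a^i to a^i or a^{ir}, and a^k b to a^{k r^j + s(1 − r)} b. Rotations commute with
-- each other; a rotation a^i commutes with some conjugate of a reflection iff it is central, i.e.
-- i(r − 1) ≡ 0 (mod 4n), which means n ∣ i for odd n and 2n ∣ i for even n. Two reflections have
-- commuting conjugates always when n is odd, and iff their exponents have the same parity when n
-- is even. Hence adjacency in CSCom only depends on the type of an element (central rotation,
-- non-central rotation, class of reflections), and H[Γ] has the same adjacency once its vertices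
-- carry these types; a type-preserving bijection of the vertex sets is then an isomorphism.

module Submission where

open import Defs
open import Data.Nat as ℕ using (ℕ; suc; NonZero; _<_; _≤_; s≤s; z≤n)
import Data.Nat.Properties as ℕP
open import Data.Nat.DivMod using (_%_; _/_; _mod_; m≡m%n+[m/n]*n; m<n⇒m%n≡m; [m+kn]%n≡m%n; m%n<n)
open import Data.Nat.Divisibility using (_∣_; divides)
import Data.Nat.Tactic.RingSolver as ℕSolver
open import Data.Fin as Fin using (Fin; toℕ; remQuot; combine; cast)
import Data.Fin.Properties as FinP
open import Data.Bool using (Bool; true; false; _xor_)
open import Data.Product using (_×_; _,_; proj₁; proj₂; uncurry; ∃)
open import Data.Sum using (_⊎_; inj₁; inj₂; [_,_]′)
open import Data.Sum.Properties using (≡-dec)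
open import Data.Unit using (⊤; tt)
open import Data.Empty using (⊥; ⊥-elim)
open import Data.Integer using (ℤ; +_; -[1+_]; _+_; _*_; -_; _-_)
import Data.Integer.Properties as ℤ
open import Data.Integer.DivMod using (_%ℕ_; _/ℕ_; a≡a%ℕn+[a/ℕn]*n)
open import Data.Integer.Tactic.RingSolver using (solve-∀)
open import Function using (const; _∘_)
open import Function.Bundles using (_⇔_; mk⇔; Equivalence)
open import Function.Construct.Identity using (⇔-id)
open import Function.Construct.Composition using (_⇔-∘_)
open import Relation.Nullary using (¬_; yes; no)
open import Relation.Binary.Bundles using (Setoid)
open import Relation.Binary.Structures using (IsEquivalence)
open import Relation.Binary.Definitions using (DecidableEquality)
open import Relation.Binary.PropositionalEquality
import Relation.Binary.Reasoning.Setoid as SetoidReasoning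

open Equivalence using (to; from)

infix 4 _≡_[mod_]
data _≡_[mod_] (a b d : ℤ) : Set where
  mod-by : (t : ℤ) → a ≡ b + t * d → a ≡ b [mod d ]

module _ {d : ℤ} where

  ≡⇒≡-mod : ∀ {a b} → a ≡ b → a ≡ b [mod d ]
  ≡⇒≡-mod {a} refl = mod-by (+ 0) (lemma a d)
    where lemma : ∀ a d → a ≡ a + + 0 * d
          lemma = solve-∀

  ≡-mod-refl : ∀ {a} → a ≡ a [mod d ]
  ≡-mod-refl = ≡⇒≡-mod refl

  ≡-mod-sym : ∀ {a b} → a ≡ b [mod d ] → b ≡ a [mod d ]
  ≡-mod-sym {b = b} (mod-by t refl) = mod-by (- t) (lemma b t d)
    where lemma : ∀ b t d → b ≡ b + t * d + (- t) * d
          lemma = solve-∀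

  ≡-mod-trans : ∀ {a b c} → a ≡ b [mod d ] → b ≡ c [mod d ] → a ≡ c [mod d ]
  ≡-mod-trans {c = c} (mod-by t refl) (mod-by s refl) = mod-by (t + s) (lemma c s t d)
    where lemma : ∀ c s t d → c + s * d + t * d ≡ c + (t + s) * d
          lemma = solve-∀

  ≡-mod-isEquivalence : IsEquivalence (λ a b → a ≡ b [mod d ])
  ≡-mod-isEquivalence = record { refl = ≡-mod-refl ; sym = ≡-mod-sym ; trans = ≡-mod-trans }

  ≡-mod-+ : ∀ {a a' b b'} → a ≡ a' [mod d ] → b ≡ b' [mod d ] → a + b ≡ a' + b' [mod d ]
  ≡-mod-+ {a' = a'} {b' = b'} (mod-by t refl) (mod-by s refl) = mod-by (t + s) (lemma a' b' t s d)
    where lemma : ∀ a b t s d → a + t * d + (b + s * d) ≡ a + b + (t + s) * d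
          lemma = solve-∀

  ≡-mod-* : ∀ {a a' b b'} → a ≡ a' [mod d ] → b ≡ b' [mod d ] → a * b ≡ a' * b' [mod d ]
  ≡-mod-* {a' = a'} {b' = b'} (mod-by t refl) (mod-by s refl) =
    mod-by (a' * s + t * b' + t * s * d) (lemma a' b' t s d)
    where lemma : ∀ a b t s d → (a + t * d) * (b + s * d) ≡ a * b + (a * s + t * b + t * s * d) * d
          lemma = solve-∀

  +-congˡ-mod : ∀ a {b b'} → b ≡ b' [mod d ] → a + b ≡ a + b' [mod d ]
  +-congˡ-mod a = ≡-mod-+ (≡-mod-refl {a})

  +-congʳ-mod : ∀ b {a a'} → a ≡ a' [mod d ] → a + b ≡ a' + b [mod d ]
  +-congʳ-mod b eq = ≡-mod-+ eq (≡-mod-refl {b})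

  *-congˡ-mod : ∀ a {b b'} → b ≡ b' [mod d ] → a * b ≡ a * b' [mod d ]
  *-congˡ-mod a = ≡-mod-* (≡-mod-refl {a})

  *-congʳ-mod : ∀ b {a a'} → a ≡ a' [mod d ] → a * b ≡ a' * b [mod d ]
  *-congʳ-mod b eq = ≡-mod-* eq (≡-mod-refl {b})

  ≡-mod-neg : ∀ {a b} → a ≡ b [mod d ] → - a ≡ - b [mod d ]
  ≡-mod-neg {b = b} (mod-by t refl) = mod-by (- t) (lemma b t d)
    where lemma : ∀ b t d → - (b + t * d) ≡ - b + (- t) * d
          lemma = solve-∀

  ≡-mod-cancelʳ-+ : ∀ {a b c} → a + c ≡ b + c [mod d ] → a ≡ b [mod d ]
  ≡-mod-cancelʳ-+ {a} {b} {c} (mod-by t eq) = mod-by t (begin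
    a                    ≡⟨ add-sub a c ⟩
    a + c - c            ≡⟨ cong (_- c) eq ⟩
    b + c + t * d - c    ≡⟨ sub-cancel b c t d ⟩
    b + t * d            ∎)
    where
    open ≡-Reasoning
    add-sub : ∀ a c → a ≡ a + c - c
    add-sub = solve-∀
    sub-cancel : ∀ b c t d → b + c + t * d - c ≡ b + t * d
    sub-cancel = solve-∀

≡-mod-setoid : ℤ → Setoid _ _
≡-mod-setoid d = record
  { Carrier = ℤ ; _≈_ = λ a b → a ≡ b [mod d ] ; isEquivalence = ≡-mod-isEquivalence }

module ≡-mod-Reasoning (d : ℤ) = SetoidReasoning (≡-mod-setoid d)

≡-mod-divisor : ∀ {a b e d} k → e ≡ k * d → a ≡ b [mod e ] → a ≡ b [mod d ]
≡-mod-divisor {b = b} {d = d} k refl (mod-by t refl) =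
  mod-by (t * k) (cong (λ x → b + x) (sym (ℤ.*-assoc t k d)))

%-≡-mod : ∀ a d .{{_ : NonZero d}} → + (a % d) ≡ + a [mod + d ]
%-≡-mod a d = ≡-mod-sym (mod-by (+ (a / d)) (begin
  + a                        ≡⟨ cong +_ (m≡m%n+[m/n]*n a d) ⟩
  + (a % d ℕ.+ a / d ℕ.* d)  ≡⟨ ℤ.pos-+ (a % d) (a / d ℕ.* d) ⟩
  + (a % d) + + (a / d ℕ.* d) ≡⟨ cong (λ x → + (a % d) + x) (ℤ.pos-* (a / d) d) ⟩
  + (a % d) + + (a / d) * + d ∎))
  where open ≡-Reasoning

%ℕ-≡-mod : ∀ z d .{{_ : NonZero d}} → + (z %ℕ d) ≡ z [mod + d ]
%ℕ-≡-mod z d = ≡-mod-sym (mod-by (z /ℕ d) (a≡a%ℕn+[a/ℕn]*n z d))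

private
  %-≡-shift : ∀ {a b} k d .{{_ : NonZero d}} → + a ≡ + b + + k * + d → a % d ≡ b % d
  %-≡-shift {a} {b} k d eq = begin
    a % d                ≡⟨ cong (_% d) (ℤ.+-injective (begin
      + a                    ≡⟨ eq ⟩
      + b + + k * + d        ≡⟨ cong (λ x → + b + x) (sym (ℤ.pos-* k d)) ⟩
      + b + + (k ℕ.* d)      ≡⟨ sym (ℤ.pos-+ b (k ℕ.* d)) ⟩
      + (b ℕ.+ k ℕ.* d)      ∎)) ⟩
    (b ℕ.+ k ℕ.* d) % d  ≡⟨ [m+kn]%n≡m%n b k d ⟩
    b % d                ∎
    where open ≡-Reasoning

  solve-for-left : ∀ a b t d → a ≡ b + t * d → b ≡ a + (- t) * d
  solve-for-left a b t d eq = trans (cancel b t d) (cong (λ x → x + (- t) * d) (sym eq))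
    where cancel : ∀ b t d → b ≡ b + t * d + (- t) * d
          cancel = solve-∀

≡-mod⇒%-≡ : ∀ {a b} d .{{_ : NonZero d}} → + a ≡ + b [mod + d ] → a % d ≡ b % d
≡-mod⇒%-≡ d (mod-by (+ k) eq)    = %-≡-shift k d eq
≡-mod⇒%-≡ {a} {b} d (mod-by -[1+ k ] eq) =
  sym (%-≡-shift (suc k) d (solve-for-left (+ a) (+ b) -[1+ k ] (+ d) eq))

≡-mod⇒≡ : ∀ {a b d} → a < d → b < d → + a ≡ + b [mod + d ] → a ≡ b
≡-mod⇒≡ {a} {b} {d} a<d b<d eq = begin
  a      ≡⟨ sym (m<n⇒m%n≡m a<d) ⟩
  a % d  ≡⟨ ≡-mod⇒%-≡ d eq ⟩
  b % d  ≡⟨ m<n⇒m%n≡m b<d ⟩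
  b      ∎
  where
  open ≡-Reasoning
  instance
    d≢0 : NonZero d
    d≢0 = ℕ.>-nonZero (ℕP.≤-<-trans z≤n a<d)

multiple-plus-≡-mod : ∀ g c q → + (g ℕ.* c ℕ.+ q) ≡ + q [mod + g ]
multiple-plus-≡-mod g c q = mod-by (+ c) (begin
  + (g ℕ.* c ℕ.+ q)    ≡⟨ cong +_ (ℕP.+-comm (g ℕ.* c) q) ⟩
  + (q ℕ.+ g ℕ.* c)    ≡⟨ ℤ.pos-+ q (g ℕ.* c) ⟩
  + q + + (g ℕ.* c)    ≡⟨ cong (λ x → + q + x) (ℤ.pos-* g c) ⟩
  + q + + g * + c      ≡⟨ cong (λ x → + q + x) (ℤ.*-comm (+ g) (+ c)) ⟩
  + q + + c * + g      ∎)
  where open ≡-Reasoning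

IsGraphOf : (Γ : Graph) → (V Γ → V Γ → Set) → Set
IsGraphOf Γ R = ∀ x y → Adj Γ x y ⇔ (x ≢ y × R x y)

module _ {Γ Δ : Graph} {RΓ : V Γ → V Γ → Set} {RΔ : V Δ → V Δ → Set}
         (graphΓ : IsGraphOf Γ RΓ) (graphΔ : IsGraphOf Δ RΔ)
         (f : V Γ → V Δ) (g : V Δ → V Γ)
         (g∘f : ∀ x → g (f x) ≡ x) (f∘g : ∀ y → f (g y) ≡ y)
         (R⇔R : ∀ x y → RΓ x y ⇔ RΔ (f x) (f y)) where

  ≅ᴳ-byInverse : Γ ≅ᴳ Δ
  ≅ᴳ-byInverse = record
    { to = f ; from = g ; from-to = g∘f ; to-from = f∘g
    ; adj→ = λ x y adj → let (x≢y , rel) = to (graphΓ x y) adj in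
        from (graphΔ (f x) (f y)) (f-injective x≢y , to (R⇔R x y) rel)
    ; adj← = λ x y adj → let (fx≢fy , rel) = to (graphΔ (f x) (f y)) adj in
        from (graphΓ x y) (fx≢fy ∘ cong f , from (R⇔R x y) rel)
    }
    where
    f-injective : ∀ {x y} → x ≢ y → f x ≢ f y
    f-injective {x} {y} x≢y fx≡fy = x≢y (trans (sym (g∘f x)) (trans (cong g fx≡fy) (g∘f y)))

-- Adjacency in CSCom and in H[Γ] depends only on these types of vertices.
data Kind : Set where
  central noncentral : Kind
  reflections        : Fin 2 → Kind

Compatible : Kind → Kind → Set
Compatible central          _                = ⊤
Compatible noncentral       central          = ⊤
Compatible noncentral       noncentral       = ⊤
Compatible noncentral       (reflections _)  = ⊥
Compatible (reflections _)  central          = ⊤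
Compatible (reflections _)  noncentral       = ⊥
Compatible (reflections a)  (reflections b)  = a ≡ b

Compatible-refl : ∀ k → Compatible k k
Compatible-refl central         = tt
Compatible-refl noncentral      = tt
Compatible-refl (reflections a) = refl

Compatible-sym : ∀ k l → Compatible k l → Compatible l k
Compatible-sym central         central         _ = tt
Compatible-sym central         noncentral      _ = tt
Compatible-sym central         (reflections _) _ = tt
Compatible-sym noncentral      central         _ = tt
Compatible-sym noncentral      noncentral      _ = tt
Compatible-sym (reflections _) central         _ = tt
Compatible-sym (reflections a) (reflections b) a≡b = sym a≡b

Compatible-centralʳ : ∀ k → Compatible k central
Compatible-centralʳ central         = tt
Compatible-centralʳ noncentral      = tt
Compatible-centralʳ (reflections _) = tt

Faithful : (H : Graph) → (V H → Kind) → Set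
Faithful H κ = ∀ i j → i ≢ j → Adj H i j ⇔ Compatible (κ i) (κ j)

K-faithful : ∀ m k → Faithful (K m) (const k)
K-faithful m k i j i≢j = mk⇔ (const (Compatible-refl k)) (const i≢j)

∪-faithful : ∀ {A B κ₁ κ₂} → Faithful A κ₁ → Faithful B κ₂ →
  (∀ a b → ¬ Compatible (κ₁ a) (κ₂ b)) → Faithful (A ∪ᴳ B) [ κ₁ , κ₂ ]′
∪-faithful fA fB incompatible (inj₁ a) (inj₁ a') ne = fA a a' (ne ∘ cong inj₁)
∪-faithful fA fB incompatible (inj₂ b) (inj₂ b') ne = fB b b' (ne ∘ cong inj₂)
∪-faithful {κ₁ = κ₁} {κ₂} fA fB incompatible (inj₁ a) (inj₂ b) ne =
  mk⇔ ⊥-elim (incompatible a b)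
∪-faithful {κ₁ = κ₁} {κ₂} fA fB incompatible (inj₂ b) (inj₁ a) ne =
  mk⇔ ⊥-elim (incompatible a b ∘ Compatible-sym (κ₂ b) (κ₁ a))

∨-faithful : ∀ {A B κ} → Faithful A (const central) → Faithful B κ →
  Faithful (A ∨ᴳ B) [ const central , κ ]′
∨-faithful fA fB (inj₁ a) (inj₁ a') ne = fA a a' (ne ∘ cong inj₁)
∨-faithful fA fB (inj₂ b) (inj₂ b') ne = fB b b' (ne ∘ cong inj₂)
∨-faithful fA fB (inj₁ a) (inj₂ b) ne = ⇔-id _
∨-faithful {κ = κ} fA fB (inj₂ b) (inj₁ a) ne = mk⇔ (const (Compatible-centralʳ (κ b))) (const tt)

Complete : Graph → Set
Complete Γ = ∀ u v → Adj Γ u v ⇔ u ≢ v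

module _ {H : Graph} {Γ : V H → Graph} (_≟_ : DecidableEquality (V H))
         (complete : ∀ i → Complete (Γ i)) {κ : V H → Kind} (faithful : Faithful H κ) where

  compose-irreflexive : ∀ w → ¬ Adj (compose H Γ) w w
  compose-irreflexive (i , u) (inj₁ (refl , adj)) = to (complete i u u) adj refl
  compose-irreflexive (i , u) (inj₂ (i≢i , _))    = i≢i refl

  compose-isGraphOf : IsGraphOf (compose H Γ) (λ w w' → Compatible (κ (proj₁ w)) (κ (proj₁ w')))
  compose-isGraphOf w w' = mk⇔ (λ adj → distinct adj , compatible w w' adj) (adjacent w w')
    where
    distinct : Adj (compose H Γ) w w' → w ≢ w'
    distinct adj refl = compose-irreflexive w adj

    compatible : ∀ w w' → Adj (compose H Γ) w w' → Compatible (κ (proj₁ w)) (κ (proj₁ w'))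
    compatible (i , _) _ (inj₁ (refl , _))  = Compatible-refl (κ i)
    compatible (i , _) (j , _) (inj₂ (i≢j , adj)) = to (faithful i j i≢j) adj

    adjacent : ∀ w w' → w ≢ w' × Compatible (κ (proj₁ w)) (κ (proj₁ w')) → Adj (compose H Γ) w w'
    adjacent (i , u) (j , v) (w≢w' , c) with i ≟ j
    ... | yes refl = inj₁ (refl , from (complete i u v) (w≢w' ∘ cong (i ,_)))
    ... | no i≢j   = inj₂ (i≢j , from (faithful i j i≢j) c)

toℕ-remQuot : ∀ {k} g (i : Fin (k ℕ.* g)) →
  toℕ i ≡ g ℕ.* toℕ (proj₁ (remQuot {k} g i)) ℕ.+ toℕ (proj₂ (remQuot {k} g i))
toℕ-remQuot {k} g i = trans (cong toℕ (sym (FinP.combine-remQuot {k} g i)))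
  (FinP.toℕ-combine (proj₁ (remQuot {k} g i)) (proj₂ (remQuot {k} g i)))

cast-combine-remQuot : ∀ {N k} g (e : N ≡ k ℕ.* g) i →
  cast (sym e) (uncurry combine (remQuot {k} g (cast e i))) ≡ i
cast-combine-remQuot {k = k} g e i =
  trans (cong (cast (sym e)) (FinP.combine-remQuot {k} g (cast e i))) (FinP.cast-involutive (sym e) e i)

remQuot-cast-combine : ∀ {N k} g (e : N ≡ k ℕ.* g) p →
  remQuot {k} g (cast e (cast (sym e) (uncurry combine p))) ≡ p
remQuot-cast-combine {k = k} g e (c , q) =
  trans (cong (remQuot {k} g) (FinP.cast-involutive e (sym e) (combine c q))) (FinP.remQuot-combine c q)

module Semidihedral (m : ℕ) where

  open SD (suc m) public

  N R Mℤ : ℤ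
  N  = + suc m
  R  = + r
  Mℤ = + M

  Mℤ≡4N : Mℤ ≡ + 4 * N
  Mℤ≡4N = ℤ.pos-* 4 (suc m)

  R≡2N-1 : R ≡ + 2 * N - + 1
  R≡2N-1 = lemma (+ m)
    where lemma : ∀ x → x + ((+ 1 + x) + + 0) ≡ + 2 * (+ 1 + x) - + 1
          lemma = solve-∀

  infix 4 _≋_
  _≋_ : ℤ → ℤ → Set
  a ≋ b = a ≡ b [mod Mℤ ]

  open ≡-mod-Reasoning Mℤ

  R²≋1 : R * R ≋ + 1
  R²≋1 = mod-by (N - + 1) (expand N R Mℤ R≡2N-1 Mℤ≡4N)
    where
    square : ∀ N → (+ 2 * N - + 1) * (+ 2 * N - + 1) ≡ + 1 + (N - + 1) * (+ 4 * N)
    square = solve-∀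
    expand : ∀ N R M → R ≡ + 2 * N - + 1 → M ≡ + 4 * N → R * R ≡ + 1 + (N - + 1) * M
    expand N R M refl refl = square N

  rot ref : Fin M → Elem
  rot i = (i , false)
  ref i = (i , true)

  ⟦_⟧ : Fin M → ℤ
  ⟦ i ⟧ = + toℕ i

  exponent : Elem → ℤ
  exponent x = ⟦ proj₁ x ⟧

  twistℤ : Bool → ℤ → ℤ
  twistℤ false z = z
  twistℤ true  z = z * R

  twistℤ-cong : ∀ j {a b} → a ≋ b → twistℤ j a ≋ twistℤ j b
  twistℤ-cong false eq = eq
  twistℤ-cong true  eq = *-congʳ-mod R eq

  pos-twist : ∀ j k → + twist j k ≡ twistℤ j (+ k)
  pos-twist false k = refl
  pos-twist true  k = ℤ.pos-* k r

  ⟦⟧-mod : ∀ a → ⟦ a mod M ⟧ ≋ + a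
  ⟦⟧-mod a = ≡-mod-trans (≡⇒≡-mod (cong +_ (FinP.toℕ-fromℕ< _))) (%-≡-mod a M)

  ⟦⟧-injective : ∀ {i j} → ⟦ i ⟧ ≋ ⟦ j ⟧ → i ≡ j
  ⟦⟧-injective eq = FinP.toℕ-injective (≡-mod⇒≡ (FinP.toℕ<n _) (FinP.toℕ<n _) eq)

  Elem-≡ : ∀ {x y} → exponent x ≋ exponent y → proj₂ x ≡ proj₂ y → x ≡ y
  Elem-≡ {i , _} eq refl = cong (_, _) (⟦⟧-injective eq)

  exponent-· : ∀ x y → exponent (x · y) ≋ exponent x + twistℤ (proj₂ x) (exponent y)
  exponent-· (i , j) (k , l) = begin
    ⟦ (toℕ i ℕ.+ twist j (toℕ k)) mod M ⟧  ≈⟨ ⟦⟧-mod _ ⟩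
    + (toℕ i ℕ.+ twist j (toℕ k))          ≡⟨ ℤ.pos-+ (toℕ i) _ ⟩
    ⟦ i ⟧ + + twist j (toℕ k)              ≡⟨ cong (λ z → ⟦ i ⟧ + z) (pos-twist j (toℕ k)) ⟩
    ⟦ i ⟧ + twistℤ j ⟦ k ⟧                 ∎

  exponent-inv : ∀ x → exponent (inv x) ≋ twistℤ (proj₂ x) (- exponent x)
  exponent-inv (i , j) = begin
    ⟦ twist j (M ℕ.∸ toℕ i) mod M ⟧  ≈⟨ ⟦⟧-mod _ ⟩
    + twist j (M ℕ.∸ toℕ i)          ≡⟨ pos-twist j _ ⟩
    twistℤ j (+ (M ℕ.∸ toℕ i))       ≈⟨ twistℤ-cong j M∸i≋-i ⟩
    twistℤ j (- ⟦ i ⟧)               ∎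
    where
    M∸i≡M-i : + (M ℕ.∸ toℕ i) ≡ Mℤ - ⟦ i ⟧
    M∸i≡M-i = sym (trans (ℤ.m-n≡m⊖n M (toℕ i)) (ℤ.≤-⊖ (ℕP.<⇒≤ (FinP.toℕ<n i))))
    reorder : ∀ a M → M - a ≡ - a + + 1 * M
    reorder = solve-∀
    M∸i≋-i : + (M ℕ.∸ toℕ i) ≋ - ⟦ i ⟧
    M∸i≋-i = mod-by (+ 1) (trans M∸i≡M-i (reorder ⟦ i ⟧ Mℤ))

  proj₂-conj : ∀ g x → proj₂ (conj g x) ≡ proj₂ x
  proj₂-conj (_ , false) (_ , false) = refl
  proj₂-conj (_ , false) (_ , true)  = refl
  proj₂-conj (_ , true)  (_ , false) = refl
  proj₂-conj (_ , true)  (_ , true)  = refl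

  exponent-conj : ∀ g x → exponent (conj g x) ≋
    exponent g + twistℤ (proj₂ g) (exponent x)
      + twistℤ (proj₂ g xor proj₂ x) (twistℤ (proj₂ g) (- exponent g))
  exponent-conj g x = ≡-mod-trans (exponent-· (g · x) (inv g))
    (≡-mod-+ (exponent-· g x) (twistℤ-cong (proj₂ g xor proj₂ x) (exponent-inv g)))

  exponent-conj-rot : ∀ g i → exponent (conj g (rot i)) ≋ twistℤ (proj₂ g) ⟦ i ⟧
  exponent-conj-rot (s , false) i = ≡-mod-trans (exponent-conj (s , false) (rot i))
    (≡⇒≡-mod (cancel ⟦ s ⟧ ⟦ i ⟧))
    where cancel : ∀ s i → s + i + - s ≡ i
          cancel = solve-∀
  exponent-conj-rot (s , true) i = begin
    exponent (conj (s , true) (rot i))    ≈⟨ exponent-conj (s , true) (rot i) ⟩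
    ⟦ s ⟧ + ⟦ i ⟧ * R + - ⟦ s ⟧ * R * R   ≡⟨ regroup ⟦ s ⟧ ⟦ i ⟧ R ⟩
    ⟦ i ⟧ * R + ⟦ s ⟧ - ⟦ s ⟧ * (R * R)
      ≈⟨ +-congˡ-mod (⟦ i ⟧ * R + ⟦ s ⟧) (≡-mod-neg (*-congˡ-mod ⟦ s ⟧ R²≋1)) ⟩
    ⟦ i ⟧ * R + ⟦ s ⟧ - ⟦ s ⟧ * + 1       ≡⟨ cancel ⟦ s ⟧ ⟦ i ⟧ R ⟩
    ⟦ i ⟧ * R                             ∎
    where
    regroup : ∀ s i R → s + i * R + - s * R * R ≡ i * R + s - s * (R * R)
    regroup = solve-∀
    cancel : ∀ s i R → i * R + s - s * + 1 ≡ i * R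
    cancel = solve-∀

  exponent-conj-ref : ∀ g k →
    exponent (conj g (ref k)) ≋ twistℤ (proj₂ g) ⟦ k ⟧ + exponent g * (+ 1 - R)
  exponent-conj-ref (s , false) k = ≡-mod-trans (exponent-conj (s , false) (ref k))
    (≡⇒≡-mod (regroup ⟦ s ⟧ ⟦ k ⟧ R))
    where regroup : ∀ s k R → s + k + - s * R ≡ k + s * (+ 1 - R)
          regroup = solve-∀
  exponent-conj-ref (s , true) k = begin
    exponent (conj (s , true) (ref k))   ≈⟨ exponent-conj (s , true) (ref k) ⟩
    ⟦ s ⟧ + ⟦ k ⟧ * R + - ⟦ s ⟧ * R      ≡⟨ regroup ⟦ s ⟧ ⟦ k ⟧ R ⟩
    ⟦ k ⟧ * R + ⟦ s ⟧ * (+ 1 - R)        ∎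
    where regroup : ∀ s k R → s + k * R + - s * R ≡ k * R + s * (+ 1 - R)
          regroup = solve-∀

  -- a^v is central iff it commutes with b, i.e. v r ≡ v (mod 4n).
  Central : ℤ → Set
  Central v = v * R ≋ v

  Central-resp : ∀ {v w} → v ≋ w → Central v → Central w
  Central-resp v≋w c = ≡-mod-trans (*-congʳ-mod R (≡-mod-sym v≋w)) (≡-mod-trans c v≋w)

  Central-twist : ∀ j {v} → Central (twistℤ j v) → Central v
  Central-twist false c = c
  Central-twist true {v} c = begin
    v * R              ≈⟨ c ⟨
    v * R * R          ≡⟨ ℤ.*-assoc v R R ⟩
    v * (R * R)        ≈⟨ *-congˡ-mod v R²≋1 ⟩
    v * + 1            ≡⟨ ℤ.*-identityʳ v ⟩
    v                  ∎

  comm-by-exponent : ∀ x y →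
    exponent x + twistℤ (proj₂ x) (exponent y) ≋ exponent y + twistℤ (proj₂ y) (exponent x) →
    x · y ≡ y · x
  comm-by-exponent x y eq = Elem-≡
    (≡-mod-trans (exponent-· x y) (≡-mod-trans eq (≡-mod-sym (exponent-· y x))))
    (xor-comm (proj₂ x) (proj₂ y))
    where
    xor-comm : ∀ a b → a xor b ≡ b xor a
    xor-comm false false = refl
    xor-comm false true  = refl
    xor-comm true  false = refl
    xor-comm true  true  = refl

  rot-comm : ∀ i k → rot i · rot k ≡ rot k · rot i
  rot-comm i k = comm-by-exponent (rot i) (rot k) (≡⇒≡-mod (ℤ.+-comm ⟦ i ⟧ ⟦ k ⟧))

  Central⇒comm : ∀ {i} y → Central ⟦ i ⟧ → rot i · y ≡ y · rot i
  Central⇒comm {i} (k , false) c = rot-comm i k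
  Central⇒comm {i} (k , true)  c = comm-by-exponent (rot i) (ref k)
    (≡-mod-trans (≡⇒≡-mod (ℤ.+-comm ⟦ i ⟧ ⟦ k ⟧)) (+-congˡ-mod ⟦ k ⟧ (≡-mod-sym c)))

  comm⇒Central : ∀ x y → proj₂ x ≡ false → proj₂ y ≡ true → x · y ≡ y · x →
    Central (exponent x)
  comm⇒Central (i , false) (k , true) refl refl comm = ≡-mod-sym (≡-mod-cancelʳ-+ (begin
    ⟦ i ⟧ + ⟦ k ⟧          ≈⟨ exponent-· (rot i) (ref k) ⟨
    exponent (rot i · ref k) ≡⟨ cong exponent comm ⟩
    exponent (ref k · rot i) ≈⟨ exponent-· (ref k) (rot i) ⟩
    ⟦ k ⟧ + ⟦ i ⟧ * R      ≡⟨ ℤ.+-comm ⟦ k ⟧ (⟦ i ⟧ * R) ⟩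
    ⟦ i ⟧ * R + ⟦ k ⟧      ∎))

  Supercommute : Elem → Elem → Set
  Supercommute x y = ∃ λ x' → ∃ λ y' → x' ∈Cl x × y' ∈Cl y × (x' · y') ≡ (y' · x')

  ε : Elem
  ε = (Fin.zero , false)

  ∈Cl-refl : ∀ x → x ∈Cl x
  ∈Cl-refl (i , j) = ε ,
    Elem-≡ (≡-mod-sym (≡-mod-trans (exponent-conj ε (i , j)) (≡⇒≡-mod (drop-zeros j))))
           (sym (proj₂-conj ε (i , j)))
    where
    drop-zeros : ∀ j → + 0 + ⟦ i ⟧ + twistℤ j (+ 0) ≡ ⟦ i ⟧
    drop-zeros false = trans (ℤ.+-identityʳ (+ 0 + ⟦ i ⟧)) (ℤ.+-identityˡ ⟦ i ⟧)
    drop-zeros true  = trans (ℤ.+-identityʳ (+ 0 + ⟦ i ⟧)) (ℤ.+-identityˡ ⟦ i ⟧)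

  comm⇒Supercommute : ∀ {x y} → x · y ≡ y · x → Supercommute x y
  comm⇒Supercommute {x} {y} comm = x , y , ∈Cl-refl x , ∈Cl-refl y , comm

  Supercommute-sym : ∀ {x y} → Supercommute x y → Supercommute y x
  Supercommute-sym (x' , y' , x'∈x , y'∈y , comm) = y' , x' , y'∈y , x'∈x , sym comm

  Supercommute-rot-rot : ∀ i k → Supercommute (rot i) (rot k)
  Supercommute-rot-rot i k = comm⇒Supercommute (rot-comm i k)

  Supercommute-rot-ref⇔Central : ∀ i k → Supercommute (rot i) (ref k) ⇔ Central ⟦ i ⟧
  Supercommute-rot-ref⇔Central i k = mk⇔ isCentral (λ c → comm⇒Supercommute (Central⇒comm (ref k) c))
    where
    isCentral : Supercommute (rot i) (ref k) → Central ⟦ i ⟧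
    isCentral (_ , _ , (g , refl) , (h , refl) , comm) =
      Central-twist (proj₂ g) (Central-resp (exponent-conj-rot g i)
        (comm⇒Central _ _ (proj₂-conj g (rot i)) (proj₂-conj h (ref k)) comm))

  fromℤ : ℤ → Fin M
  fromℤ z = (z %ℕ M) mod M

  ⟦fromℤ⟧ : ∀ z → ⟦ fromℤ z ⟧ ≋ z
  ⟦fromℤ⟧ z = ≡-mod-trans (⟦⟧-mod _) (%ℕ-≡-mod z M)

  Supercommute-ref-ref : ∀ i k S → let E = ⟦ k ⟧ + S * (+ 1 - R) in
    ⟦ i ⟧ + E * R ≋ E + ⟦ i ⟧ * R → Supercommute (ref i) (ref k)
  Supercommute-ref-ref i k S comm-exponent =
    ref i , ref v , ∈Cl-refl (ref i) , (rot s , v≡conj) , comm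
    where
    E = ⟦ k ⟧ + S * (+ 1 - R)
    v = fromℤ E
    s = fromℤ S
    v≡conj : ref v ≡ conj (rot s) (ref k)
    v≡conj = Elem-≡ (begin
      ⟦ v ⟧                       ≈⟨ ⟦fromℤ⟧ E ⟩
      ⟦ k ⟧ + S * (+ 1 - R)       ≈⟨ +-congˡ-mod ⟦ k ⟧ (*-congʳ-mod (+ 1 - R) (⟦fromℤ⟧ S)) ⟨
      ⟦ k ⟧ + ⟦ s ⟧ * (+ 1 - R)   ≈⟨ exponent-conj-ref (rot s) k ⟨
      exponent (conj (rot s) (ref k)) ∎) refl
    comm : ref i · ref v ≡ ref v · ref i
    comm = comm-by-exponent (ref i) (ref v) (begin
      ⟦ i ⟧ + ⟦ v ⟧ * R   ≈⟨ +-congˡ-mod ⟦ i ⟧ (*-congʳ-mod R (⟦fromℤ⟧ E)) ⟩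
      ⟦ i ⟧ + E * R       ≈⟨ comm-exponent ⟩
      E + ⟦ i ⟧ * R       ≈⟨ +-congʳ-mod (⟦ i ⟧ * R) (⟦fromℤ⟧ E) ⟨
      ⟦ v ⟧ + ⟦ i ⟧ * R   ∎)

  ≋⇒≡-mod-2 : ∀ {a b} → a ≋ b → a ≡ b [mod + 2 ]
  ≋⇒≡-mod-2 = ≡-mod-divisor (+ 2 * N) (trans Mℤ≡4N (four N))
    where four : ∀ N → + 4 * N ≡ + 2 * N * + 2
          four = solve-∀

  twistℤ-≡-mod-2 : ∀ j a → twistℤ j a ≡ a [mod + 2 ]
  twistℤ-≡-mod-2 false a = ≡-mod-refl
  twistℤ-≡-mod-2 true  a = mod-by (a * (N - + 1)) (trans (cong (a *_) R≡2N-1) (odd a N))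
    where odd : ∀ a N → a * (+ 2 * N - + 1) ≡ a + a * (N - + 1) * + 2
          odd = solve-∀

  exponent-conj-ref-≡-mod-2 : ∀ g k → exponent (conj g (ref k)) ≡ ⟦ k ⟧ [mod + 2 ]
  exponent-conj-ref-≡-mod-2 g k = ≡-mod-trans (≋⇒≡-mod-2 (exponent-conj-ref g k))
    (≡-mod-trans (≡-mod-+ (twistℤ-≡-mod-2 (proj₂ g) ⟦ k ⟧) (*-congˡ-mod (exponent g) 1-R≡0))
                 (≡⇒≡-mod (drop-zero ⟦ k ⟧ (exponent g))))
    where
    1-R≡0 : + 1 - R ≡ + 0 [mod + 2 ]
    1-R≡0 = mod-by (+ 1 - N) (trans (cong (λ z → + 1 - z) R≡2N-1) (even N))
      where even : ∀ N → + 1 - (+ 2 * N - + 1) ≡ + 0 + (+ 1 - N) * + 2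
            even = solve-∀
    drop-zero : ∀ k s → k + s * + 0 ≡ k
    drop-zero = solve-∀

  Central⇔remainder≡0 : ∀ {g} → (∀ v → Central v ⇔ v ≡ + 0 [mod + suc g ]) →
    ∀ i c (q : Fin (suc g)) → toℕ i ≡ suc g ℕ.* c ℕ.+ toℕ q → Central ⟦ i ⟧ ⇔ q ≡ Fin.zero
  Central⇔remainder≡0 {g} Central⇔ i c q split = mk⇔ remainder≡0 zero-remainder
    where
    ⟦i⟧≡q : ⟦ i ⟧ ≡ + toℕ q [mod + suc g ]
    ⟦i⟧≡q = ≡-mod-trans (≡⇒≡-mod (cong +_ split)) (multiple-plus-≡-mod (suc g) c (toℕ q))

    remainder≡0 : Central ⟦ i ⟧ → q ≡ Fin.zero
    remainder≡0 cen = FinP.toℕ-injective (≡-mod⇒≡ (FinP.toℕ<n q) (s≤s z≤n)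
      (≡-mod-trans (≡-mod-sym ⟦i⟧≡q) (to (Central⇔ ⟦ i ⟧) cen)))

    zero-remainder : q ≡ Fin.zero → Central ⟦ i ⟧
    zero-remainder refl = from (Central⇔ ⟦ i ⟧) ⟦i⟧≡q

  module Classification
    (kind : Elem → Kind)
    (rotation-kind : ∀ i → Central ⟦ i ⟧ × kind (rot i) ≡ central
                         ⊎ ¬ Central ⟦ i ⟧ × kind (rot i) ≡ noncentral)
    (reflection-kind : ∀ i → ∃ λ a → kind (ref i) ≡ reflections a)
    (Supercommute-ref-ref⇔ : ∀ i k →
       Supercommute (ref i) (ref k) ⇔ Compatible (kind (ref i)) (kind (ref k)))
    where

    Compatible-rot-rot : ∀ i k → Compatible (kind (rot i)) (kind (rot k))
    Compatible-rot-rot i k with rotation-kind i | rotation-kind k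
    ... | inj₁ (_ , eq) | _              rewrite eq = tt
    ... | inj₂ (_ , eq) | inj₁ (_ , eq') rewrite eq | eq' = tt
    ... | inj₂ (_ , eq) | inj₂ (_ , eq') rewrite eq | eq' = tt

    Compatible-rot-ref⇔Central : ∀ i k → Compatible (kind (rot i)) (kind (ref k)) ⇔ Central ⟦ i ⟧
    Compatible-rot-ref⇔Central i k with rotation-kind i | reflection-kind k
    ... | inj₁ (c , eq)  | _       rewrite eq       = mk⇔ (const c) (const tt)
    ... | inj₂ (¬c , eq) | _ , eq' rewrite eq | eq' = mk⇔ ⊥-elim (⊥-elim ∘ ¬c)

    Supercommute⇔Compatible : ∀ x y → Supercommute x y ⇔ Compatible (kind x) (kind y)
    Supercommute⇔Compatible (i , false) (k , false) =
      mk⇔ (const (Compatible-rot-rot i k)) (const (Supercommute-rot-rot i k))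
    Supercommute⇔Compatible (i , false) (k , true) = mk⇔
      (from (Compatible-rot-ref⇔Central i k) ∘ to (Supercommute-rot-ref⇔Central i k))
      (from (Supercommute-rot-ref⇔Central i k) ∘ to (Compatible-rot-ref⇔Central i k))
    Supercommute⇔Compatible (i , true) (k , false) = mk⇔
      (Compatible-sym _ _ ∘ from (Compatible-rot-ref⇔Central k i)
        ∘ to (Supercommute-rot-ref⇔Central k i) ∘ Supercommute-sym)
      (Supercommute-sym ∘ from (Supercommute-rot-ref⇔Central k i)
        ∘ to (Compatible-rot-ref⇔Central k i) ∘ Compatible-sym _ _)
    Supercommute⇔Compatible (i , true) (k , true) = Supercommute-ref-ref⇔ i k

  CSCom-isGraphOf : IsGraphOf CSCom Supercommute
  CSCom-isGraphOf x y = ⇔-id _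

kindOdd : ∀ n → V (Hodd n) → Kind
kindOdd n = [ const central , [ const noncentral , const (reflections Fin.zero) ]′ ]′

Hodd-faithful : ∀ n → Faithful (Hodd n) (kindOdd n)
Hodd-faithful n = ∨-faithful (K-faithful 4 central)
  (∪-faithful (K-faithful (2 ℕ.* n ℕ.∸ 2) noncentral) (K-faithful 4 (reflections Fin.zero)) (λ _ _ ()))

Γodd-complete : ∀ n i → Complete (Γodd n i)
Γodd-complete n (inj₁ _)        _ _ = ⇔-id _
Γodd-complete n (inj₂ (inj₁ _)) _ _ = ⇔-id _
Γodd-complete n (inj₂ (inj₂ _)) _ _ = ⇔-id _

Hodd-≟ : ∀ n → DecidableEquality (V (Hodd n))
Hodd-≟ n = ≡-dec Fin._≟_ (≡-dec Fin._≟_ Fin._≟_)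

module OddCase (m : ℕ) (U : ℤ) (n≡2U+1 : + suc m ≡ + 2 * U + + 1) where

  open Semidihedral m

  -- v(r − 1) = 4Uv, and U is invertible modulo n = 2U + 1.
  Central⇔≡0-mod-n : ∀ v → Central v ⇔ v ≡ + 0 [mod N ]
  Central⇔≡0-mod-n v = mk⇔ multiple-of-n Central-of-multiple
    where
    Central-of-multiple : v ≡ + 0 [mod N ] → Central v
    Central-of-multiple (mod-by w eq) = mod-by (w * U) (expand N R Mℤ v n≡2U+1 R≡2N-1 Mℤ≡4N eq)
      where
      expanded : ∀ U w → let N = + 2 * U + + 1 in
        (+ 0 + w * N) * (+ 2 * N - + 1) ≡ + 0 + w * N + w * U * (+ 4 * N)
      expanded = solve-∀
      expand : ∀ N R M v → N ≡ + 2 * U + + 1 → R ≡ + 2 * N - + 1 → M ≡ + 4 * N →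
        v ≡ + 0 + w * N → v * R ≡ v + w * U * M
      expand _ _ _ _ refl refl refl refl = expanded U w

    multiple-of-n : Central v → v ≡ + 0 [mod N ]
    multiple-of-n (mod-by t eq) = mod-by (v - + 2 * t) (solve N R Mℤ n≡2U+1 R≡2N-1 Mℤ≡4N eq)
      where
      solve : ∀ N R M → N ≡ + 2 * U + + 1 → R ≡ + 2 * N - + 1 → M ≡ + 4 * N →
        v * R ≡ v + t * M → v ≡ + 0 + (v - + 2 * t) * N
      solve N _ _ refl refl refl eq = begin
        v                         ≡⟨ split v U ⟩
        v * N - + 2 * (v * U)     ≡⟨ cong (λ z → v * N - + 2 * z) vU≡tN ⟩
        v * N - + 2 * (t * N)     ≡⟨ collect v t N ⟩
        + 0 + (v - + 2 * t) * N   ∎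
        where
        open ≡-Reasoning
        split : ∀ v U → v ≡ v * (+ 2 * U + + 1) - + 2 * (v * U)
        split = solve-∀
        collect : ∀ v t N → v * N - + 2 * (t * N) ≡ + 0 + (v - + 2 * t) * N
        collect = solve-∀
        times-4 : ∀ v U → + 4 * (v * U) ≡ v * (+ 2 * (+ 2 * U + + 1) - + 1) - v
        times-4 = solve-∀
        cancel-v : ∀ v t N → v + t * (+ 4 * N) - v ≡ + 4 * (t * N)
        cancel-v = solve-∀
        vU≡tN : v * U ≡ t * N
        vU≡tN = ℤ.*-cancelˡ-≡ (+ 4) (v * U) (t * N) (begin
          + 4 * (v * U)                          ≡⟨ times-4 v U ⟩
          v * (+ 2 * N - + 1) - v                ≡⟨ cong (_- v) eq ⟩
          v + t * (+ 4 * N) - v                  ≡⟨ cancel-v v t N ⟩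
          + 4 * (t * N)                          ∎)

  -- For S = (i − k)(U + 1) the conjugate a^E b of a^k b has i − E = (i − k)n², so
  -- (i − E)(1 − r) = −4Un(i − k)n ≡ 0 (mod 4n) and a^E b commutes with a^i b.
  Supercommute-refs : ∀ i k → Supercommute (ref i) (ref k)
  Supercommute-refs i k = Supercommute-ref-ref i k S
    (mod-by (U * N * (⟦ k ⟧ - ⟦ i ⟧)) (expand N R Mℤ n≡2U+1 R≡2N-1 Mℤ≡4N))
    where
    S = - (⟦ k ⟧ - ⟦ i ⟧) * (U + + 1)
    expanded : ∀ U I K → let N = + 2 * U + + 1 ; R = + 2 * N - + 1 ; S = - (K - I) * (U + + 1) in
      I + (K + S * (+ 1 - R)) * R ≡ K + S * (+ 1 - R) + I * R + U * N * (K - I) * (+ 4 * N)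
    expanded = solve-∀
    expand : ∀ N R M → N ≡ + 2 * U + + 1 → R ≡ + 2 * N - + 1 → M ≡ + 4 * N →
      ⟦ i ⟧ + (⟦ k ⟧ + S * (+ 1 - R)) * R
        ≡ ⟦ k ⟧ + S * (+ 1 - R) + ⟦ i ⟧ * R + U * N * (⟦ k ⟧ - ⟦ i ⟧) * M
    expand _ _ _ refl refl refl = expanded U ⟦ i ⟧ ⟦ k ⟧

  Vertex : Set
  Vertex = V (compose (Hodd (suc m)) (Γodd (suc m)))

  4m≡[2n-2]*2 : 4 ℕ.* m ≡ (2 ℕ.* suc m ℕ.∸ 2) ℕ.* 2
  4m≡[2n-2]*2 = trans (regroup m) (cong (λ z → (z ℕ.∸ 2) ℕ.* 2) (sym (ℕP.*-suc 2 m)))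
    where regroup : ∀ m → 4 ℕ.* m ≡ (2 ℕ.* m) ℕ.* 2
          regroup = ℕSolver.solve-∀

  -- The 4(n − 1) non-central rotations fill the 2n − 2 blocks K₂ in turn.
  place-noncentral : Fin 4 × Fin m → Vertex
  place-noncentral (c , q) =
    let (h , b) = remQuot 2 (cast 4m≡[2n-2]*2 (combine c q)) in (inj₂ (inj₁ h) , b)

  place-rotation : Fin 4 × Fin (suc m) → Vertex
  place-rotation (c , Fin.zero)  = (inj₁ c , Fin.zero)
  place-rotation (c , Fin.suc q) = place-noncentral (c , q)

  encode : Elem → Vertex
  encode (i , false) = place-rotation (remQuot {4} (suc m) i)
  encode (i , true)  = (inj₂ (inj₂ (proj₁ (remQuot {4} (suc m) i))) , proj₂ (remQuot {4} (suc m) i))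

  decode-noncentral : Fin (2 ℕ.* suc m ℕ.∸ 2) × Fin 2 → Elem
  decode-noncentral (h , b) = let (c , q) = remQuot {4} m (cast (sym 4m≡[2n-2]*2) (combine h b)) in
    (combine c (Fin.suc q) , false)

  decode : Vertex → Elem
  decode (inj₁ c , _)        = (combine c Fin.zero , false)
  decode (inj₂ (inj₁ h) , b) = decode-noncentral (h , b)
  decode (inj₂ (inj₂ c) , q) = (combine c q , true)

  decode-place-rotation : ∀ p → decode (place-rotation p) ≡ (uncurry combine p , false)
  decode-place-rotation (c , Fin.zero)  = refl
  decode-place-rotation (c , Fin.suc q) =
    cong (λ p → (combine (proj₁ p) (Fin.suc (proj₂ p)) , false)) (begin
      remQuot {4} m (cast (sym e) (uncurry combine (remQuot {2 ℕ.* suc m ℕ.∸ 2} 2 (cast e (combine c q)))))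
        ≡⟨ cong (remQuot m ∘ cast (sym e)) (FinP.combine-remQuot {2 ℕ.* suc m ℕ.∸ 2} 2 _) ⟩
      remQuot m (cast (sym e) (cast e (combine c q)))
        ≡⟨ cong (remQuot m) (FinP.cast-involutive (sym e) e _) ⟩
      remQuot m (combine c q)
        ≡⟨ FinP.remQuot-combine c q ⟩
      (c , q) ∎)
    where
    open ≡-Reasoning
    e = 4m≡[2n-2]*2

  decode-encode : ∀ x → decode (encode x) ≡ x
  decode-encode (i , false) = trans (decode-place-rotation (remQuot {4} (suc m) i))
                              (cong (_, false) (FinP.combine-remQuot {4} (suc m) i))
  decode-encode (i , true)  = cong (_, true) (FinP.combine-remQuot {4} (suc m) i)

  encode-decode : ∀ y → encode (decode y) ≡ y
  encode-decode (inj₁ c , Fin.zero) = cong place-rotation (FinP.remQuot-combine c Fin.zero)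
  encode-decode (inj₂ (inj₂ c) , q) =
    cong (λ p → (inj₂ (inj₂ (proj₁ p)) , proj₂ p)) (FinP.remQuot-combine c q)
  encode-decode (inj₂ (inj₁ h) , b) = begin
    place-rotation (remQuot (suc m) (combine (proj₁ p) (Fin.suc (proj₂ p))))
      ≡⟨ cong place-rotation (FinP.remQuot-combine (proj₁ p) (Fin.suc (proj₂ p))) ⟩
    place-noncentral p
      ≡⟨ cong (λ r → (inj₂ (inj₁ (proj₁ r)) , proj₂ r)) (begin
           remQuot 2 (cast e (uncurry combine p))
             ≡⟨ cong (remQuot 2 ∘ cast e) (FinP.combine-remQuot {4} m y) ⟩
           remQuot 2 (cast e y)
             ≡⟨ cong (remQuot 2) (FinP.cast-involutive e (sym e) (combine h b)) ⟩
           remQuot 2 (combine h b)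
             ≡⟨ FinP.remQuot-combine h b ⟩
           (h , b) ∎) ⟩
    (inj₂ (inj₁ h) , b) ∎
    where
    open ≡-Reasoning
    e = 4m≡[2n-2]*2
    y = cast (sym e) (combine h b)
    p = remQuot {4} m y

  kind : Elem → Kind
  kind x = kindOdd (suc m) (proj₁ (encode x))

  rotation-kind : ∀ i → Central ⟦ i ⟧ × kind (rot i) ≡ central
                      ⊎ ¬ Central ⟦ i ⟧ × kind (rot i) ≡ noncentral
  rotation-kind i = classify (remQuot {4} (suc m) i) (toℕ-remQuot (suc m) i)
    where
    classify : ∀ p → toℕ i ≡ suc m ℕ.* toℕ (proj₁ p) ℕ.+ toℕ (proj₂ p) →
      Central ⟦ i ⟧ × kindOdd (suc m) (proj₁ (place-rotation p)) ≡ central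
      ⊎ ¬ Central ⟦ i ⟧ × kindOdd (suc m) (proj₁ (place-rotation p)) ≡ noncentral
    classify (c , q) split with Central⇔remainder≡0 Central⇔≡0-mod-n i (toℕ c) q split
    classify (c , Fin.zero)  split | Central⇔0 = inj₁ (from Central⇔0 refl , refl)
    classify (c , Fin.suc q) split | Central⇔0 = inj₂ ((λ ()) ∘ to Central⇔0 , refl)

  reflection-kind : ∀ i → ∃ λ a → kind (ref i) ≡ reflections a
  reflection-kind i = Fin.zero , refl

  open Classification kind rotation-kind reflection-kind
    (λ i k → mk⇔ (const refl) (const (Supercommute-refs i k)))

  CSCom≅composition : CSCom ≅ᴳ compose (Hodd (suc m)) (Γodd (suc m))
  CSCom≅composition = ≅ᴳ-byInverse CSCom-isGraphOf
    (compose-isGraphOf (Hodd-≟ (suc m)) (Γodd-complete (suc m)) (Hodd-faithful (suc m)))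
    encode decode decode-encode encode-decode Supercommute⇔Compatible

kindEven : ∀ n → V (Heven n) → Kind
kindEven n = [ const central
             , [ [ const noncentral , const (reflections Fin.zero) ]′
               , const (reflections (Fin.suc Fin.zero)) ]′ ]′

Heven-faithful : ∀ n → Faithful (Heven n) (kindEven n)
Heven-faithful n = ∨-faithful (K-faithful 2 central)
  (∪-faithful
    (∪-faithful (K-faithful (2 ℕ.* n ℕ.∸ 1) noncentral) (K-faithful 1 (reflections Fin.zero)) (λ _ _ ()))
    (K-faithful 1 (reflections (Fin.suc Fin.zero))) incompatible)
  where
  incompatible : ∀ a b → Compatible ([ const noncentral , const (reflections Fin.zero) ]′ a)
                                     (reflections (Fin.suc Fin.zero)) → ⊥
  incompatible (inj₁ _) _ ()
  incompatible (inj₂ _) _ ()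

Γeven-complete : ∀ n i → Complete (Γeven n i)
Γeven-complete n (inj₁ _)               _ _ = ⇔-id _
Γeven-complete n (inj₂ (inj₁ (inj₁ _))) _ _ = ⇔-id _
Γeven-complete n (inj₂ (inj₁ (inj₂ _))) _ _ = ⇔-id _
Γeven-complete n (inj₂ (inj₂ _))        _ _ = ⇔-id _

Heven-≟ : ∀ n → DecidableEquality (V (Heven n))
Heven-≟ n = ≡-dec Fin._≟_ (≡-dec (≡-dec Fin._≟_ Fin._≟_) Fin._≟_)

module EvenCase (m : ℕ) (U : ℤ) (n≡2U : + suc m ≡ + 2 * U) where

  open Semidihedral m

  -- v(r − 1) = 2v(2U − 1), and 2U − 1 is invertible modulo 4U = 2n as (2U − 1)² ≡ 1.
  Central⇔≡0-mod-2n : ∀ v → Central v ⇔ v ≡ + 0 [mod + (2 ℕ.* suc m) ]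
  Central⇔≡0-mod-2n v = mk⇔ multiple-of-2n Central-of-multiple
    where
    2n≡2N : + (2 ℕ.* suc m) ≡ + 2 * N
    2n≡2N = ℤ.pos-* 2 (suc m)

    Central-of-multiple : v ≡ + 0 [mod + (2 ℕ.* suc m) ] → Central v
    Central-of-multiple (mod-by w eq) =
      mod-by (w * (N - + 1)) (expand N R Mℤ _ v R≡2N-1 Mℤ≡4N 2n≡2N eq)
      where
      expanded : ∀ N w →
        (+ 0 + w * (+ 2 * N)) * (+ 2 * N - + 1) ≡ + 0 + w * (+ 2 * N) + w * (N - + 1) * (+ 4 * N)
      expanded = solve-∀
      expand : ∀ N R M D v → R ≡ + 2 * N - + 1 → M ≡ + 4 * N → D ≡ + 2 * N →
        v ≡ + 0 + w * D → v * R ≡ v + w * (N - + 1) * M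
      expand N _ _ _ _ refl refl refl refl = expanded N w

    multiple-of-2n : Central v → v ≡ + 0 [mod + (2 ℕ.* suc m) ]
    multiple-of-2n (mod-by t eq) = mod-by (t * (+ 2 * U - + 1) - (U - + 1) * v)
      (solve N R Mℤ _ n≡2U R≡2N-1 Mℤ≡4N 2n≡2N eq)
      where
      solve : ∀ N R M D → N ≡ + 2 * U → R ≡ + 2 * N - + 1 → M ≡ + 4 * N → D ≡ + 2 * N →
        v * R ≡ v + t * M → v ≡ + 0 + (t * (+ 2 * U - + 1) - (U - + 1) * v) * D
      solve _ _ _ _ refl refl refl refl eq = begin
        v                                                         ≡⟨ square-trick v U ⟩
        (+ 2 * U - + 1) * (v * (+ 2 * U - + 1)) - + 4 * U * (U - + 1) * v
          ≡⟨ cong (λ z → (+ 2 * U - + 1) * z - + 4 * U * (U - + 1) * v) v[2U-1]≡4Ut ⟩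
        (+ 2 * U - + 1) * (+ 4 * U * t) - + 4 * U * (U - + 1) * v  ≡⟨ collect v t U ⟩
        + 0 + (t * (+ 2 * U - + 1) - (U - + 1) * v) * (+ 2 * (+ 2 * U)) ∎
        where
        open ≡-Reasoning
        square-trick : ∀ v U → v ≡ (+ 2 * U - + 1) * (v * (+ 2 * U - + 1)) - + 4 * U * (U - + 1) * v
        square-trick = solve-∀
        collect : ∀ v t U → (+ 2 * U - + 1) * (+ 4 * U * t) - + 4 * U * (U - + 1) * v
                          ≡ + 0 + (t * (+ 2 * U - + 1) - (U - + 1) * v) * (+ 2 * (+ 2 * U))
        collect = solve-∀
        times-2 : ∀ v U → + 2 * (v * (+ 2 * U - + 1)) ≡ v * (+ 2 * (+ 2 * U) - + 1) - v
        times-2 = solve-∀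
        cancel-v : ∀ v t U → v + t * (+ 4 * (+ 2 * U)) - v ≡ + 2 * (+ 4 * U * t)
        cancel-v = solve-∀
        v[2U-1]≡4Ut : v * (+ 2 * U - + 1) ≡ + 4 * U * t
        v[2U-1]≡4Ut = ℤ.*-cancelˡ-≡ (+ 2) _ _ (begin
          + 2 * (v * (+ 2 * U - + 1))             ≡⟨ times-2 v U ⟩
          v * (+ 2 * (+ 2 * U) - + 1) - v         ≡⟨ cong (_- v) eq ⟩
          v + t * (+ 4 * (+ 2 * U)) - v           ≡⟨ cancel-v v t U ⟩
          + 2 * (+ 4 * U * t)                     ∎)

  -- a^a b and a^b b commute iff (a − b)(1 − r) ≡ 0 (mod 4n), i.e. (a − b)(1 − 2U) ≡ 0
  -- (mod 4U); since 1 − 2U is odd, a − b is even.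
  comm-refs⇒≡-mod-2 : ∀ x y → proj₂ x ≡ true → proj₂ y ≡ true → x · y ≡ y · x →
    exponent x ≡ exponent y [mod + 2 ]
  comm-refs⇒≡-mod-2 (i , true) (k , true) refl refl comm
    with ≡-mod-trans (≡-mod-sym (exponent-· (ref i) (ref k)))
           (≡-mod-trans (≡⇒≡-mod (cong exponent comm)) (exponent-· (ref k) (ref i)))
  ... | mod-by t eq = mod-by (+ 2 * U * t + U * (a - b)) (solve N R Mℤ n≡2U R≡2N-1 Mℤ≡4N eq)
    where
    a = ⟦ i ⟧
    b = ⟦ k ⟧
    solve : ∀ N R M → N ≡ + 2 * U → R ≡ + 2 * N - + 1 → M ≡ + 4 * N →
      a + b * R ≡ b + a * R + t * M → a ≡ b + (+ 2 * U * t + U * (a - b)) * + 2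
    solve _ _ _ refl refl refl eq = begin
      a                                          ≡⟨ split a b U ⟩
      b + (a - b) * (+ 1 - + 2 * U) + + 2 * (U * (a - b))
        ≡⟨ cong (λ z → b + z + + 2 * (U * (a - b))) [a-b][1-2U]≡4Ut ⟩
      b + + 4 * U * t + + 2 * (U * (a - b))      ≡⟨ collect a b U t ⟩
      b + (+ 2 * U * t + U * (a - b)) * + 2      ∎
      where
      open ≡-Reasoning
      R′ = + 2 * (+ 2 * U) - + 1
      split : ∀ a b U → a ≡ b + (a - b) * (+ 1 - + 2 * U) + + 2 * (U * (a - b))
      split = solve-∀
      collect : ∀ a b U t → b + + 4 * U * t + + 2 * (U * (a - b)) ≡ b + (+ 2 * U * t + U * (a - b)) * + 2
      collect = solve-∀
      difference : ∀ a b U → + 2 * ((a - b) * (+ 1 - + 2 * U))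
        ≡ (a + b * (+ 2 * (+ 2 * U) - + 1)) - (b + a * (+ 2 * (+ 2 * U) - + 1))
      difference = solve-∀
      cancel : ∀ x t U → x + t * (+ 4 * (+ 2 * U)) - x ≡ + 2 * (+ 4 * U * t)
      cancel = solve-∀
      [a-b][1-2U]≡4Ut : (a - b) * (+ 1 - + 2 * U) ≡ + 4 * U * t
      [a-b][1-2U]≡4Ut = ℤ.*-cancelˡ-≡ (+ 2) _ _ (begin
        + 2 * ((a - b) * (+ 1 - + 2 * U))        ≡⟨ difference a b U ⟩
        (a + b * R′) - (b + a * R′)              ≡⟨ cong (_- (b + a * R′)) eq ⟩
        (b + a * R′ + t * (+ 4 * (+ 2 * U))) - (b + a * R′) ≡⟨ cancel (b + a * R′) t U ⟩
        + 2 * (+ 4 * U * t)                      ∎)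

  Supercommute-refs⇔≡-mod-2 : ∀ i k → Supercommute (ref i) (ref k) ⇔ ⟦ i ⟧ ≡ ⟦ k ⟧ [mod + 2 ]
  Supercommute-refs⇔≡-mod-2 i k = mk⇔ same-parity supercommute
    where
    same-parity : Supercommute (ref i) (ref k) → ⟦ i ⟧ ≡ ⟦ k ⟧ [mod + 2 ]
    same-parity (_ , _ , (g , refl) , (h , refl) , comm) =
      ≡-mod-trans (≡-mod-sym (exponent-conj-ref-≡-mod-2 g i))
        (≡-mod-trans (comm-refs⇒≡-mod-2 _ _ (proj₂-conj g (ref i)) (proj₂-conj h (ref k)) comm)
          (exponent-conj-ref-≡-mod-2 h k))

    supercommute : ⟦ i ⟧ ≡ ⟦ k ⟧ [mod + 2 ] → Supercommute (ref i) (ref k)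
    -- For i = k + 2w, conjugating a^k b by a^S with S = w(1 − 2U) gives a^i b itself.
    supercommute (mod-by w eq) = Supercommute-ref-ref i k S
      (mod-by (w * (+ 1 - U) * (+ 2 - + 4 * U)) (expand N R Mℤ ⟦ i ⟧ n≡2U R≡2N-1 Mℤ≡4N eq))
      where
      S = w * (+ 1 - + 2 * U)
      expanded : ∀ U K w → let N = + 2 * U ; R = + 2 * N - + 1 ; S = w * (+ 1 - + 2 * U) in
        K + w * + 2 + (K + S * (+ 1 - R)) * R
          ≡ K + S * (+ 1 - R) + (K + w * + 2) * R + w * (+ 1 - U) * (+ 2 - + 4 * U) * (+ 4 * N)
      expanded = solve-∀
      expand : ∀ N R M I → N ≡ + 2 * U → R ≡ + 2 * N - + 1 → M ≡ + 4 * N → I ≡ ⟦ k ⟧ + w * + 2 →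
        I + (⟦ k ⟧ + S * (+ 1 - R)) * R
          ≡ ⟦ k ⟧ + S * (+ 1 - R) + I * R + w * (+ 1 - U) * (+ 2 - + 4 * U) * M
      expand _ _ _ _ refl refl refl refl = expanded U ⟦ k ⟧ w

  Vertex : Set
  Vertex = V (compose (Heven (suc m)) (Γeven (suc m)))

  4n≡2*2n : 4 ℕ.* suc m ≡ 2 ℕ.* (2 ℕ.* suc m)
  4n≡2*2n = ℕP.*-assoc 2 2 (suc m)

  4n≡2n*2 : 4 ℕ.* suc m ≡ (2 ℕ.* suc m) ℕ.* 2
  4n≡2n*2 = trans 4n≡2*2n (ℕP.*-comm 2 (2 ℕ.* suc m))

  rotation-split : Fin M → Fin 2 × Fin (2 ℕ.* suc m)
  rotation-split i = remQuot {2} (2 ℕ.* suc m) (cast 4n≡2*2n i)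

  reflection-split : Fin M → Fin (2 ℕ.* suc m) × Fin 2
  reflection-split i = remQuot {2 ℕ.* suc m} 2 (cast 4n≡2n*2 i)

  place-rotation : Fin 2 × Fin (2 ℕ.* suc m) → Vertex
  place-rotation (c , Fin.zero)  = (inj₁ c , Fin.zero)
  place-rotation (c , Fin.suc q) = (inj₂ (inj₁ (inj₁ q)) , c)

  place-reflection : Fin (2 ℕ.* suc m) × Fin 2 → Vertex
  place-reflection (a , Fin.zero)          = (inj₂ (inj₁ (inj₂ Fin.zero)) , a)
  place-reflection (a , Fin.suc Fin.zero)  = (inj₂ (inj₂ Fin.zero) , a)

  encode : Elem → Vertex
  encode (i , false) = place-rotation (rotation-split i)
  encode (i , true)  = place-reflection (reflection-split i)

  decode : Vertex → Elem
  decode (inj₁ c , _)                = (cast (sym 4n≡2*2n) (combine c Fin.zero) , false)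
  decode (inj₂ (inj₁ (inj₁ q)) , c)  = (cast (sym 4n≡2*2n) (combine c (Fin.suc q)) , false)
  decode (inj₂ (inj₁ (inj₂ _)) , a)  = (cast (sym 4n≡2n*2) (combine a Fin.zero) , true)
  decode (inj₂ (inj₂ _) , a)         = (cast (sym 4n≡2n*2) (combine a (Fin.suc Fin.zero)) , true)

  decode-place-rotation : ∀ p →
    decode (place-rotation p) ≡ (cast (sym 4n≡2*2n) (uncurry combine p) , false)
  decode-place-rotation (c , Fin.zero)  = refl
  decode-place-rotation (c , Fin.suc q) = refl

  decode-place-reflection : ∀ p →
    decode (place-reflection p) ≡ (cast (sym 4n≡2n*2) (uncurry combine p) , true)
  decode-place-reflection (a , Fin.zero)         = refl
  decode-place-reflection (a , Fin.suc Fin.zero) = refl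

  decode-encode : ∀ x → decode (encode x) ≡ x
  decode-encode (i , false) = trans (decode-place-rotation (rotation-split i))
    (cong (_, false) (cast-combine-remQuot {k = 2} (2 ℕ.* suc m) 4n≡2*2n i))
  decode-encode (i , true)  = trans (decode-place-reflection (reflection-split i))
    (cong (_, true) (cast-combine-remQuot {k = 2 ℕ.* suc m} 2 4n≡2n*2 i))

  encode-decode : ∀ y → encode (decode y) ≡ y
  encode-decode (inj₁ c , Fin.zero) =
    cong place-rotation (remQuot-cast-combine (2 ℕ.* suc m) 4n≡2*2n (c , Fin.zero))
  encode-decode (inj₂ (inj₁ (inj₁ q)) , c) =
    cong place-rotation (remQuot-cast-combine (2 ℕ.* suc m) 4n≡2*2n (c , Fin.suc q))
  encode-decode (inj₂ (inj₁ (inj₂ Fin.zero)) , a) =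
    cong place-reflection (remQuot-cast-combine 2 4n≡2n*2 (a , Fin.zero))
  encode-decode (inj₂ (inj₂ Fin.zero) , a) =
    cong place-reflection (remQuot-cast-combine 2 4n≡2n*2 (a , Fin.suc Fin.zero))

  kind : Elem → Kind
  kind x = kindEven (suc m) (proj₁ (encode x))

  rotation-kind : ∀ i → Central ⟦ i ⟧ × kind (rot i) ≡ central
                      ⊎ ¬ Central ⟦ i ⟧ × kind (rot i) ≡ noncentral
  rotation-kind i = classify (rotation-split i)
    (trans (sym (FinP.toℕ-cast 4n≡2*2n i)) (toℕ-remQuot (2 ℕ.* suc m) (cast 4n≡2*2n i)))
    where
    classify : ∀ p → toℕ i ≡ 2 ℕ.* suc m ℕ.* toℕ (proj₁ p) ℕ.+ toℕ (proj₂ p) →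
      Central ⟦ i ⟧ × kindEven (suc m) (proj₁ (place-rotation p)) ≡ central
      ⊎ ¬ Central ⟦ i ⟧ × kindEven (suc m) (proj₁ (place-rotation p)) ≡ noncentral
    classify (c , q) split with Central⇔remainder≡0 Central⇔≡0-mod-2n i (toℕ c) q split
    classify (c , Fin.zero)  split | Central⇔0 = inj₁ (from Central⇔0 refl , refl)
    classify (c , Fin.suc q) split | Central⇔0 = inj₂ ((λ ()) ∘ to Central⇔0 , refl)

  parity : Fin M → Fin 2
  parity i = proj₂ (reflection-split i)

  kind-ref : ∀ i → kind (ref i) ≡ reflections (parity i)
  kind-ref i = kind-place (reflection-split i)
    where
    kind-place : ∀ p → kindEven (suc m) (proj₁ (place-reflection p)) ≡ reflections (proj₂ p)
    kind-place (a , Fin.zero)         = refl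
    kind-place (a , Fin.suc Fin.zero) = refl

  ⟦⟧≡parity : ∀ i → ⟦ i ⟧ ≡ + toℕ (parity i) [mod + 2 ]
  ⟦⟧≡parity i = ≡-mod-trans
    (≡⇒≡-mod (cong +_ (trans (sym (FinP.toℕ-cast 4n≡2n*2 i)) (toℕ-remQuot 2 (cast 4n≡2n*2 i)))))
    (multiple-plus-≡-mod 2 (toℕ (proj₁ (reflection-split i))) (toℕ (parity i)))

  ≡-mod-2⇔same-parity : ∀ i k → ⟦ i ⟧ ≡ ⟦ k ⟧ [mod + 2 ] ⇔ parity i ≡ parity k
  ≡-mod-2⇔same-parity i k = mk⇔
    (λ eq → FinP.toℕ-injective (≡-mod⇒≡ (FinP.toℕ<n (parity i)) (FinP.toℕ<n (parity k))
      (≡-mod-trans (≡-mod-sym (⟦⟧≡parity i)) (≡-mod-trans eq (⟦⟧≡parity k)))))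
    (λ eq → ≡-mod-trans (⟦⟧≡parity i)
      (≡-mod-trans (≡⇒≡-mod (cong (λ p → + toℕ p) eq)) (≡-mod-sym (⟦⟧≡parity k))))

  Supercommute-ref-ref⇔ : ∀ i k → Supercommute (ref i) (ref k) ⇔ Compatible (kind (ref i)) (kind (ref k))
  Supercommute-ref-ref⇔ i k rewrite kind-ref i | kind-ref k =
    ≡-mod-2⇔same-parity i k ⇔-∘ Supercommute-refs⇔≡-mod-2 i k

  open Classification kind rotation-kind (λ i → parity i , kind-ref i) Supercommute-ref-ref⇔

  CSCom≅composition : CSCom ≅ᴳ compose (Heven (suc m)) (Γeven (suc m))
  CSCom≅composition = ≅ᴳ-byInverse CSCom-isGraphOf
    (compose-isGraphOf (Heven-≟ (suc m)) (Γeven-complete (suc m)) (Heven-faithful (suc m)))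
    encode decode decode-encode encode-decode Supercommute⇔Compatible

odd⇒2U+1 : ∀ n → ¬ 2 ∣ n → ∃ λ U → + n ≡ + 2 * U + + 1
odd⇒2U+1 n 2∤n with n % 2 | m%n<n n 2 | m≡m%n+[m/n]*n n 2
... | 0 | _               | n≡ = ⊥-elim (2∤n (divides (n / 2) n≡))
... | 1 | _               | n≡ = + (n / 2) , (begin
  + n                     ≡⟨ cong +_ n≡ ⟩
  + (1 ℕ.+ n / 2 ℕ.* 2)   ≡⟨ cong +_ (ℕP.+-comm 1 (n / 2 ℕ.* 2)) ⟩
  + (n / 2 ℕ.* 2 ℕ.+ 1)   ≡⟨ ℤ.pos-+ (n / 2 ℕ.* 2) 1 ⟩
  + (n / 2 ℕ.* 2) + + 1   ≡⟨ cong (_+ + 1) (trans (ℤ.pos-* (n / 2) 2) (ℤ.*-comm (+ (n / 2)) (+ 2))) ⟩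
  + 2 * + (n / 2) + + 1   ∎)
  where open ≡-Reasoning
... | suc (suc _) | s≤s (s≤s ()) | _

even⇒2U : ∀ n → 2 ∣ n → ∃ λ U → + n ≡ + 2 * U
even⇒2U n (divides q n≡q*2) = + q , trans (cong +_ n≡q*2) (trans (ℤ.pos-* q 2) (ℤ.*-comm (+ q) (+ 2)))

mainTheorem17 : (n : ℕ) → .{{_ : NonZero n}} → 2 ≤ n →
    ((¬ (2 ∣ n)) → SD.CSCom n ≅ᴳ compose (Hodd n) (Γodd n))
    × ((2 ∣ n) → SD.CSCom n ≅ᴳ compose (Heven n) (Γeven n))
mainTheorem17 (suc m) _ =
  (λ odd → let (U , n≡2U+1) = odd⇒2U+1 (suc m) odd in OddCase.CSCom≅composition m U n≡2U+1) ,
  (λ even → let (U , n≡2U) = even⇒2U (suc m) even in EvenCase.CSCom≅composition m U n≡2U)
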